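{- Let $G$ be a finite simple chordal graph with at least one edge. Then there is a non-isolated vertex $w\in V(G)$ such that $\mathcal{N}(\overline{G})$ collapses to $\mathcal{N}(\overline{G-w})$ and $\alpha(G)=\alpha(G-w)$.
   Context: A graph is chordal if it has no induced cycle of length at least $4$. $\overline{H}$ is the complement graph of $H$, $G-w$ is the induced subgraph on $V(G)\setminus\{w\}$, and $\alpha$ is the independence number. The neighborhood complex $\mathcal{N}(H)$ is the simplicial complex on $V(H)$ whose simplices are the subsets contained in the set of neighbors $N_H(v)$ of some vertex $v$. For a simplicial complex $X$, a face $\sigma$ is free if it is not maximal and is contained in exactly one other face $\tau\neq\sigma$; removing all faces containing $\sigma$ is a simplicial collapse, and $X$ collapses to a subcomplex $Y$ if $Y$ is obtained from $X$ by a finite sequence of simplicial collapses. -}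

module Defs where

open import Data.Nat using (ℕ; zero; suc; _+_; _≤_; _%_; NonZero)
open import Data.Fin using (Fin; toℕ; _≟_)
open import Data.Fin.Subset using (Subset; _∈_; _⊆_; Nonempty; ∣_∣)
open import Data.Bool using (Bool; true; false; _∧_; not)
open import Data.Bool.Properties using (∧-comm; ∧-zeroʳ)
open import Data.Product using (Σ; ∃; ∃-syntax; _×_; _,_)
open import Data.Sum using (_⊎_)
open import Data.Empty using (⊥; ⊥-elim)
open import Relation.Nullary using (¬_; yes; no; does)
open import Relation.Binary.PropositionalEquality using (_≡_; _≢_; refl; sym; trans; cong; cong₂)
open import Function using (_⇔_)
open import Function.Definitions using (Injective)

-- Allowing V ⊆ Fin n lets the induced subgraph G - w live on the same
-- ambient type, with vertex set V(G) \ {w}.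

record Graph (n : ℕ) : Set where
  field
    V      : Fin n → Bool
    E      : Fin n → Fin n → Bool
    E-sym  : ∀ u v → E u v ≡ E v u
    E-irr  : ∀ v → E v v ≡ false
    E-V    : ∀ u v → E u v ≡ true → (V u ≡ true) × (V v ≡ true)
open Graph public

neq : ∀ {n} → Fin n → Fin n → Bool
neq u v = not (does (u ≟ v))

neq-sym : ∀ {n} (u v : Fin n) → neq u v ≡ neq v u
neq-sym u v with u ≟ v | v ≟ u
... | yes _ | yes _ = refl
... | yes p | no ¬q = ⊥-elim (¬q (sym p))
... | no ¬p | yes q = ⊥-elim (¬p (sym q))
... | no _ | no _ = refl

neq-irr : ∀ {n} (u : Fin n) → neq u u ≡ false
neq-irr u with u ≟ u
... | yes _ = refl
... | no ¬p = ⊥-elim (¬p refl)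

private
  ∧-true : ∀ {a b} → a ∧ b ≡ true → (a ≡ true) × (b ≡ true)
  ∧-true {true} {true} refl = refl , refl

complement : ∀ {n} → Graph n → Graph n
complement {n} G = record
  { V = V G
  ; E = E'
  ; E-sym = λ u v → cong₂ _∧_ (∧-comm (V G u) (V G v))
                     (cong₂ _∧_ (neq-sym u v) (cong not (E-sym G u v)))
  ; E-irr = λ v → trans
                     (cong₂ _∧_ refl (cong₂ _∧_ (neq-irr v) refl))
                     (∧-zeroʳ (V G v ∧ V G v))
  ; E-V = λ u v eq → let (a , _) = ∧-true {V G u ∧ V G v} eq in ∧-true a
  }
  where
  E' : Fin n → Fin n → Bool
  E' u v = (V G u ∧ V G v) ∧ (neq u v ∧ not (E G u v))

_─v_ : ∀ {n} → Graph n → Fin n → Graph n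
_─v_ {n} G w = record
  { V = λ u → V G u ∧ neq u w
  ; E = E'
  ; E-sym = λ u v → cong₂ _∧_ (E-sym G u v) (∧-comm (neq u w) (neq v w))
  ; E-irr = λ v → cong₂ _∧_ (E-irr G v) refl
  ; E-V = λ u v eq →
      let (e , nn) = ∧-true {E G u v} eq
          (nu , nv) = ∧-true {neq u w} nn
          (vu , vv) = E-V G u v e
      in cong₂ _∧_ vu nu , cong₂ _∧_ vv nv
  }
  where
  E' : Fin n → Fin n → Bool
  E' u v = E G u v ∧ (neq u w ∧ neq v w)

CycConsec : (k : ℕ) .{{_ : NonZero k}} → Fin k → Fin k → Set
CycConsec k i j = (suc (toℕ i) % k ≡ toℕ j) ⊎ (suc (toℕ j) % k ≡ toℕ i)

IsInducedCycle : ∀ {n} → Graph n → (m : ℕ) → (Fin (4 + m) → Fin n) → Set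
IsInducedCycle G m c =
  Injective _≡_ _≡_ c ×
  (∀ i → V G (c i) ≡ true) ×
  (∀ i j → (E G (c i) (c j) ≡ true) ⇔ CycConsec (4 + m) i j)

Chordal : ∀ {n} → Graph n → Set
Chordal {n} G = ∀ (m : ℕ) (c : Fin (4 + m) → Fin n) → ¬ IsInducedCycle G m c

HasEdge : ∀ {n} → Graph n → Set
HasEdge G = ∃[ u ] ∃[ v ] (E G u v ≡ true)

NonIsolated : ∀ {n} → Graph n → Fin n → Set
NonIsolated G w = ∃[ u ] (E G w u ≡ true)

IsIndependent : ∀ {n} → Graph n → Subset n → Set
IsIndependent G S =
  (∀ u → u ∈ S → V G u ≡ true) ×
  (∀ u v → u ∈ S → v ∈ S → E G u v ≡ false)

IsIndepNumber : ∀ {n} → Graph n → ℕ → Set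
IsIndepNumber G k =
  (∃[ S ] (IsIndependent G S × ∣ S ∣ ≡ k)) ×
  (∀ S → IsIndependent G S → ∣ S ∣ ≤ k)

-- Simplicial complexes on vertex set ⊆ Fin n, given by their (nonempty) faces.

Complex : ℕ → Set₁
Complex n = Subset n → Set

NbhdComplex : ∀ {n} → Graph n → Complex n
NbhdComplex G σ = Nonempty σ × ∃[ v ] ((V G v ≡ true) × (∀ u → u ∈ σ → E G v u ≡ true))

IsFreePair : ∀ {n} → Complex n → Subset n → Subset n → Set
IsFreePair X σ τ =
  X σ × X τ × σ ⊆ τ × σ ≢ τ ×
  (∀ ρ → X ρ → σ ⊆ ρ → (ρ ≡ σ) ⊎ (ρ ≡ τ))

ElemCollapse : ∀ {n} → Complex n → Complex n → Set
ElemCollapse X Y = ∃[ σ ] ∃[ τ ] (IsFreePair X σ τ ×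
  (∀ ρ → Y ρ ⇔ (X ρ × ¬ (σ ⊆ ρ))))

data Collapses {n : ℕ} : Complex n → Complex n → Set₁ where
  done : ∀ {X Y} → (∀ ρ → X ρ ⇔ Y ρ) → Collapses X Y
  step : ∀ {X Z Y} → ElemCollapse X Z → Collapses Z Y → Collapses X Y

{-# OPTIONS --safe #-}
-- A chordal graph with an edge has a non-isolated simplicial vertex s (Dirac), and for any
-- neighbour w of s we get N(s) ⊆ N[w].  Exchanging w for s in an independent set keeps it
-- independent, so α(G - w) = α(G).  In the complement the inclusion reverses: if a face ρ ∋ w of
-- N(Ḡ) lies in the Ḡ-neighbourhood of v, then v ∉ N[w] ⊇ N(s) and v ≠ s, so ρ ∪ {s} lies there
-- too.  The faces containing w thus form a cone with apex s, and removing them in free pairs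
-- (σ, σ ∪ {s}), largest σ first, collapses N(Ḡ) onto its faces avoiding w, which is N(Ḡ - w).

module Submission where

open import Defs
open import Data.Nat using (ℕ; zero; suc; _+_; _∸_; _≤_; _<_; _%_; NonZero; _≤?_; _<?_; z≤n; s≤s)
open import Data.Nat.Properties
open import Data.Nat.DivMod using (m<n⇒m%n≡m; n%n≡0)
open import Data.Nat.Induction using (<-wellFounded)
open import Data.Fin using (Fin; toℕ) renaming (zero to fzero; suc to fsuc; _≟_ to _≟ᶠ_)
open import Data.Fin.Properties using (toℕ<n; toℕ-injective; any?; all?)
open import Data.Fin.Subset
  using (Subset; inside; outside; _∈_; _∉_; _⊆_; _⊂_; _⊃_; _∪_; _-_; ⁅_⁆; ∣_∣)
  renaming (⊥ to ∅)
open import Data.Fin.Subset.Properties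
  using (_∈?_; _⊆?_; _⊂?_; anySubset?; nonempty?; ⊆-antisym; ∣p∣≤n; p⊂q⇒∣p∣<∣q∣; ∉⊥; x∈⁅x⁆;
         x∈⁅y⁆⇒x≡y; x∈p∪q⁻; x∈p∪q⁺; p⊆p∪q; p─⊥≡p; p─q⊆p; x∈p∧x≢y⇒x∈p-y)
open import Data.Fin.Subset.Induction using (⊂-wellFounded; ⊃-wellFounded)
open import Data.Bool using (true; false; _∧_; not; if_then_else_)
open import Data.Bool.Properties using (∧-conicalˡ; ∧-conicalʳ; not-injective) renaming (_≟_ to _≟ᵇ_)
open import Data.Vec using ([]; _∷_; tabulate)
open import Data.Vec.Base using (there)
open import Data.Vec.Properties using (lookup∘tabulate; []=⇒lookup; lookup⇒[]=)
open import Data.Product using (∃₂; ∃-syntax; Σ-syntax; _×_; _,_; proj₁; proj₂)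
open import Data.Sum using (_⊎_; inj₁; inj₂; [_,_]′; reduce; swap)
open import Data.Empty using (⊥; ⊥-elim)
open import Function using (_∘_; _∘′_; _⇔_; mk⇔; Equivalence)
import Function.Properties.Equivalence as ⇔
open import Induction.WellFounded using (Acc; acc)
open import Relation.Binary.Construct.Closure.ReflexiveTransitive using (Star; ε; _◅_; _◅◅_; reverse)
open import Relation.Binary.Definitions using (tri<; tri≈; tri>)
open import Relation.Binary.PropositionalEquality
  using (_≡_; _≢_; refl; sym; trans; cong; cong₂; subst; subst₂)
open import Relation.Nullary using (¬_; Dec; yes; no; does; contradiction)
open import Relation.Nullary.Decidable
  using (dec-true; map′; _×-dec_; _⊎-dec_; _→-dec_; ¬?; decidable-stable)

module Adjacency {n : ℕ} (G : Graph n) where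

  infix 4 _~_ _≁_ _~?_ _~[_]_

  _~_ : Fin n → Fin n → Set
  u ~ v = E G u v ≡ true

  _≁_ : Fin n → Fin n → Set
  u ≁ v = E G u v ≡ false

  _~?_ : ∀ u v → Dec (u ~ v)
  u ~? v = E G u v ≟ᵇ true

  ~-sym : ∀ {u v} → u ~ v → v ~ u
  ~-sym {u} {v} u~v = trans (E-sym G v u) u~v

  ≁-sym : ∀ {u v} → u ≁ v → v ≁ u
  ≁-sym {u} {v} u≁v = trans (E-sym G v u) u≁v

  ~-irrefl : ∀ {v} → ¬ v ~ v
  ~-irrefl {v} v~v with trans (sym v~v) (E-irr G v)
  ... | ()

  ~⇒≢ : ∀ {u v} → u ~ v → u ≢ v
  ~⇒≢ u~v refl = ~-irrefl u~v

  ≁⇒¬~ : ∀ {u v} → u ≁ v → ¬ u ~ v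
  ≁⇒¬~ u≁v u~v with trans (sym u~v) u≁v
  ... | ()

  ¬~⇒≁ : ∀ {u v} → ¬ u ~ v → u ≁ v
  ¬~⇒≁ {u} {v} ¬u~v with E G u v
  ... | true  = contradiction refl ¬u~v
  ... | false = refl

  ~⇒∈V : ∀ {u v} → u ~ v → V G u ≡ true
  ~⇒∈V u~v = proj₁ (E-V G _ _ u~v)

  _~[_]_ : Fin n → Subset n → Fin n → Set
  u ~[ W ] v = u ∈ W × v ∈ W × u ~ v

  ~[]-sym : ∀ {W u v} → u ~[ W ] v → v ~[ W ] u
  ~[]-sym (u∈W , v∈W , u~v) = v∈W , u∈W , ~-sym u~v

neq⇒≢ : ∀ {n} {u v : Fin n} → neq u v ≡ true → u ≢ v
neq⇒≢ {u = u} {v} h u≡v with u ≟ᶠ v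
... | yes _ = contradiction h λ ()
... | no u≢v = u≢v u≡v

≢⇒neq : ∀ {n} {u v : Fin n} → u ≢ v → neq u v ≡ true
≢⇒neq {u = u} {v} u≢v with u ≟ᶠ v
... | yes u≡v = contradiction u≡v u≢v
... | no _ = refl

module _ {n : ℕ} (G : Graph n) {u v : Fin n} where

  complement-adj⁻ : E (complement G) u v ≡ true →
                    V G u ≡ true × V G v ≡ true × u ≢ v × E G u v ≡ false
  complement-adj⁻ h =
    ∧-conicalˡ (V G u) _ inV , ∧-conicalʳ (V G u) _ inV ,
    neq⇒≢ (∧-conicalˡ (neq u v) _ rest) , not-injective (∧-conicalʳ (neq u v) _ rest)
    where
    inV : V G u ∧ V G v ≡ true
    inV = ∧-conicalˡ (V G u ∧ V G v) _ h
    rest : neq u v ∧ not (E G u v) ≡ true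
    rest = ∧-conicalʳ (V G u ∧ V G v) _ h

  complement-adj⁺ : V G u ≡ true → V G v ≡ true → u ≢ v → E G u v ≡ false →
                    E (complement G) u v ≡ true
  complement-adj⁺ Vu Vv u≢v u≁v =
    cong₂ _∧_ (cong₂ _∧_ Vu Vv) (cong₂ _∧_ (≢⇒neq u≢v) (cong not u≁v))

module _ {n : ℕ} (G : Graph n) (w : Fin n) where

  ─v-V⁻ : ∀ {u} → V (G ─v w) u ≡ true → V G u ≡ true × u ≢ w
  ─v-V⁻ {u} h = ∧-conicalˡ (V G u) _ h , neq⇒≢ (∧-conicalʳ (V G u) _ h)

  ─v-V⁺ : ∀ {u} → V G u ≡ true → u ≢ w → V (G ─v w) u ≡ true
  ─v-V⁺ Vu u≢w = cong₂ _∧_ Vu (≢⇒neq u≢w)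

  ─v-nonadj⁻ : ∀ {u v} → E (G ─v w) u v ≡ false → u ≢ w → v ≢ w → E G u v ≡ false
  ─v-nonadj⁻ {u} {v} h u≢w v≢w with E G u v
  ... | false = refl
  ... | true  = trans (sym (cong₂ _∧_ (≢⇒neq u≢w) (≢⇒neq v≢w))) h

  ─v-nonadj⁺ : ∀ {u v} → E G u v ≡ false → E (G ─v w) u v ≡ false
  ─v-nonadj⁺ u≁v = cong (_∧ _) u≁v

  complement-─v-adj⁻ : ∀ {u v} → E (complement (G ─v w)) u v ≡ true →
                       E (complement G) u v ≡ true × u ≢ w × v ≢ w
  complement-─v-adj⁻ h with complement-adj⁻ (G ─v w) h
  ... | Vu′ , Vv′ , u≢v , u≁v with ─v-V⁻ Vu′ | ─v-V⁻ Vv′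
  ...   | Vu , u≢w | Vv , v≢w = complement-adj⁺ G Vu Vv u≢v (─v-nonadj⁻ u≁v u≢w v≢w) , u≢w , v≢w

  complement-─v-adj⁺ : ∀ {u v} → E (complement G) u v ≡ true → u ≢ w → v ≢ w →
                       E (complement (G ─v w)) u v ≡ true
  complement-─v-adj⁺ h u≢w v≢w with complement-adj⁻ G h
  ... | Vu , Vv , u≢v , u≁v = complement-adj⁺ (G ─v w) (─v-V⁺ Vu u≢w) (─v-V⁺ Vv v≢w) u≢v (─v-nonadj⁺ u≁v)

module _ {n : ℕ} {P : Fin n → Set} (P? : ∀ x → Dec (P x)) where

  fromDec : Subset n
  fromDec = tabulate (λ x → does (P? x))

  ∈-fromDec⁺ : ∀ {x} → P x → x ∈ fromDec
  ∈-fromDec⁺ {x} px = lookup⇒[]= x _ (trans (lookup∘tabulate _ x) (dec-true (P? x) px))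

  ∈-fromDec⁻ : ∀ {x} → x ∈ fromDec → P x
  ∈-fromDec⁻ {x} h with P? x | trans (sym (lookup∘tabulate (λ x → does (P? x)) x)) ([]=⇒lookup h)
  ... | yes px | _ = px
  ... | no _   | ()

module _ {n : ℕ} {Q : Subset n → Set} (Q? : ∀ σ → Dec (Q σ)) where

  ⊆-maximal : ∀ {σ} → Q σ → ∃[ μ ] (Q μ × σ ⊆ μ × ∀ τ → Q τ → μ ⊆ τ → τ ≡ μ)
  ⊆-maximal {σ} = go σ (⊃-wellFounded σ)
    where
    go : ∀ σ → Acc _ σ → Q σ → ∃[ μ ] (Q μ × σ ⊆ μ × ∀ τ → Q τ → μ ⊆ τ → τ ≡ μ)
    go σ (acc rec) qσ with anySubset? (λ τ → Q? τ ×-dec σ ⊂? τ)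
    ... | yes (τ , qτ , σ⊂τ) =
      let μ , qμ , τ⊆μ , max = go τ (rec σ⊂τ) qτ in μ , qμ , (λ x∈σ → τ⊆μ (proj₁ σ⊂τ x∈σ)) , max
    ... | no ∄τ = σ , qσ , (λ x∈σ → x∈σ) , λ τ qτ σ⊆τ → ⊆-antisym (τ⊆σ τ qτ σ⊆τ) σ⊆τ
      where
      τ⊆σ : ∀ τ → Q τ → σ ⊆ τ → τ ⊆ σ
      τ⊆σ τ qτ σ⊆τ {x} x∈τ with x ∈? σ
      ... | yes x∈σ = x∈σ
      ... | no x∉σ = contradiction (τ , qτ , (λ {y} → σ⊆τ {y}) , x , x∈τ , x∉σ) ∄τ

  maximum : ∀ {σ} → Q σ → ∃[ μ ] (Q μ × ∀ τ → Q τ → ∣ τ ∣ ≤ ∣ μ ∣)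
  maximum {σ} qσ = search n (λ τ _ → ∣p∣≤n τ)
    where
    search : ∀ m → (∀ τ → Q τ → ∣ τ ∣ ≤ m) → ∃[ μ ] (Q μ × ∀ τ → Q τ → ∣ τ ∣ ≤ ∣ μ ∣)
    search m bound with anySubset? (λ τ → Q? τ ×-dec ∣ τ ∣ ≟ m)
    ... | yes (μ , qμ , refl) = μ , qμ , bound
    search zero    bound | no ∄τ = contradiction (σ , qσ , n≤0⇒n≡0 (bound σ qσ)) ∄τ
    search (suc m) bound | no ∄τ =
      search m (λ τ qτ → ≤-pred (≤∧≢⇒< (bound τ qτ) (λ eq → ∄τ (τ , qτ , eq))))

count : ∀ {n} {Q : Subset n → Set} → (∀ ρ → Dec (Q ρ)) → ℕ
count {zero}  Q? = if does (Q? []) then 1 else 0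
count {suc n} Q? = count (λ ρ → Q? (inside ∷ ρ)) + count (λ ρ → Q? (outside ∷ ρ))

count-mono : ∀ {n} {P Q : Subset n → Set} (P? : ∀ ρ → Dec (P ρ)) (Q? : ∀ ρ → Dec (Q ρ)) →
             (∀ {ρ} → P ρ → Q ρ) → count P? ≤ count Q?
count-mono {zero} P? Q? P⊆Q with P? [] | Q? []
... | yes p | no ¬q = contradiction (P⊆Q p) ¬q
... | yes _ | yes _ = ≤-refl
... | no _  | _     = z≤n
count-mono {suc n} P? Q? P⊆Q =
  +-mono-≤ (count-mono (λ ρ → P? (inside ∷ ρ)) (λ ρ → Q? (inside ∷ ρ)) P⊆Q)
           (count-mono (λ ρ → P? (outside ∷ ρ)) (λ ρ → Q? (outside ∷ ρ)) P⊆Q)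

count-< : ∀ {n} {P Q : Subset n → Set} (P? : ∀ ρ → Dec (P ρ)) (Q? : ∀ ρ → Dec (Q ρ)) →
          (∀ {ρ} → P ρ → Q ρ) → ∀ {ρ} → Q ρ → ¬ P ρ → count P? < count Q?
count-< {zero} P? Q? P⊆Q {[]} q ¬p with P? [] | Q? []
... | yes p | _     = contradiction p ¬p
... | no _  | yes _ = s≤s z≤n
... | no _  | no ¬q = contradiction q ¬q
count-< {suc n} P? Q? P⊆Q {inside ∷ ρ} q ¬p =
  +-mono-<-≤ (count-< (λ ρ → P? (inside ∷ ρ)) (λ ρ → Q? (inside ∷ ρ)) P⊆Q q ¬p)
             (count-mono (λ ρ → P? (outside ∷ ρ)) (λ ρ → Q? (outside ∷ ρ)) P⊆Q)
count-< {suc n} P? Q? P⊆Q {outside ∷ ρ} q ¬p =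
  +-mono-≤-< (count-mono (λ ρ → P? (inside ∷ ρ)) (λ ρ → Q? (inside ∷ ρ)) P⊆Q)
             (count-< (λ ρ → P? (outside ∷ ρ)) (λ ρ → Q? (outside ∷ ρ)) P⊆Q q ¬p)

y∉p-y : ∀ {n} (p : Subset n) y → y ∉ p - y
y∉p-y (_ ∷ p) fzero    ()
y∉p-y (_ ∷ p) (fsuc y) (there y∈p-y) = y∉p-y p y y∈p-y

∣p∣≤1+∣p-x∣ : ∀ {n} (p : Subset n) x → ∣ p ∣ ≤ suc ∣ p - x ∣
∣p∣≤1+∣p-x∣ (inside  ∷ p) fzero    = subst (λ q → suc ∣ p ∣ ≤ suc ∣ q ∣) (sym (p─⊥≡p p)) ≤-refl
∣p∣≤1+∣p-x∣ (outside ∷ p) fzero    = subst (λ q → ∣ p ∣ ≤ suc ∣ q ∣) (sym (p─⊥≡p p)) (n≤1+n _)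
∣p∣≤1+∣p-x∣ (inside  ∷ p) (fsuc x) = s≤s (∣p∣≤1+∣p-x∣ p x)
∣p∣≤1+∣p-x∣ (outside ∷ p) (fsuc x) = ∣p∣≤1+∣p-x∣ p x

p-y≡p : ∀ {n} {p : Subset n} {y} → y ∉ p → p - y ≡ p
p-y≡p {p = p} {y} y∉p = ⊆-antisym (p─q⊆p p ⁅ y ⁆)
  λ x∈p → x∈p∧x≢y⇒x∈p-y x∈p λ { refl → y∉p x∈p }

[p-y]∪⁅y⁆≡p : ∀ {n} {p : Subset n} {y} → y ∈ p → (p - y) ∪ ⁅ y ⁆ ≡ p
[p-y]∪⁅y⁆≡p {p = p} {y} y∈p = ⊆-antisym ⊆p p⊆
  where
  ⊆p : (p - y) ∪ ⁅ y ⁆ ⊆ p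
  ⊆p x∈ with x∈p∪q⁻ (p - y) ⁅ y ⁆ x∈
  ... | inj₁ x∈p-y = p─q⊆p p ⁅ y ⁆ x∈p-y
  ... | inj₂ x∈⁅y⁆ rewrite x∈⁅y⁆⇒x≡y y x∈⁅y⁆ = y∈p
  p⊆ : p ⊆ (p - y) ∪ ⁅ y ⁆
  p⊆ {x} x∈p with x ≟ᶠ y
  ... | yes refl = x∈p∪q⁺ (inj₂ (x∈⁅x⁆ y))
  ... | no x≢y   = x∈p∪q⁺ (inj₁ (x∈p∧x≢y⇒x∈p-y x∈p x≢y))

module Paths {n : ℕ} (G : Graph n) where

  open Adjacency G

  record Path (P : Fin n → Set) (a b : Fin n) : Set where
    field
      length   : ℕ
      vertex   : ℕ → Fin n
      start    : vertex 0 ≡ a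
      end      : vertex length ≡ b
      adjacent : ∀ i → i < length → vertex i ~ vertex (suc i)
      interior : ∀ i → 0 < i → i < length → P (vertex i)

  open Path public

  module _ {P : Fin n → Set} where

    edge-path : ∀ {a b} → a ~ b → Path P a b
    edge-path {a} {b} a~b = record
      { length = 1 ; vertex = λ { zero → a ; (suc _) → b } ; start = refl ; end = refl
      ; adjacent = λ { zero _ → a~b ; (suc _) (s≤s ()) } ; interior = λ { (suc _) _ (s≤s ()) } }

    cons-path : ∀ {a c b} → a ~ c → P c → Path P c b → Path P a b
    cons-path {a} a~c pc p = record
      { length = suc (length p) ; vertex = vertex′ ; start = refl ; end = end p
      ; adjacent = adjacent′ ; interior = interior′ }
      where
      vertex′ : ℕ → Fin n
      vertex′ zero    = a
      vertex′ (suc i) = vertex p i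
      adjacent′ : ∀ i → i < suc (length p) → vertex′ i ~ vertex′ (suc i)
      adjacent′ zero    _      = subst (a ~_) (sym (start p)) a~c
      adjacent′ (suc i) i<len = adjacent p i (≤-pred i<len)
      interior′ : ∀ i → 0 < i → i < suc (length p) → P (vertex′ i)
      interior′ (suc zero)    _ _     = subst P (sym (start p)) pc
      interior′ (suc (suc i)) _ i<len = interior p (suc i) (s≤s z≤n) (≤-pred i<len)

    detour : ∀ {W a c d b} → (∀ {v} → v ∈ W → P v) →
             a ~ c → c ∈ W → Star _~[ W ]_ c d → d ~ b → Path P a b
    detour W⊆P a~c c∈W ε d~b = cons-path a~c (W⊆P c∈W) (edge-path d~b)
    detour W⊆P a~c c∈W ((_ , c′∈W , c~c′) ◅ c′⋯d) d~b =
      cons-path a~c (W⊆P c∈W) (detour W⊆P c~c′ c′∈W c′⋯d d~b)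

    -- Repetitions count as chords, so chordless paths are simple.
    Shortcut : Fin n → Fin n → Set
    Shortcut u v = u ≡ v ⊎ u ~ v

    Chordless : ∀ {a b} → Path P a b → Set
    Chordless p = ∀ i j → suc i < j → j ≤ length p → ¬ Shortcut (vertex p i) (vertex p j)

    -- Deletes the d vertices after position i.
    module Bypass {a b} (p : Path P a b) (i d : ℕ) (0<d : 0 < d) (i+d≤k : i + d ≤ length p)
                  (link : i + d < length p → vertex p i ~ vertex p (suc (i + d)))
                  (ends : i + d ≡ length p → vertex p i ≡ b) where

      private
        k k′ : ℕ
        k  = length p
        k′ = k ∸ d

        k′+d≡k : k′ + d ≡ k
        k′+d≡k = m∸n+n≡m (≤-trans (m≤n+m d i) i+d≤k)

        i<k : i < k
        i<k = ≤-trans (m<m+n i 0<d) i+d≤k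

        shift-< : ∀ {l} → l < k′ → l + d < k
        shift-< l<k′ = subst (_ <_) k′+d≡k (+-monoˡ-< d l<k′)

      vertex′ : ℕ → Fin n
      vertex′ l with l ≤? i
      ... | yes _ = vertex p l
      ... | no  _ = vertex p (l + d)

      vertex′-≤ : ∀ {l} → l ≤ i → vertex′ l ≡ vertex p l
      vertex′-≤ {l} l≤i with l ≤? i
      ... | yes _   = refl
      ... | no  l≰i = contradiction l≤i l≰i

      vertex′-> : ∀ {l} → i < l → vertex′ l ≡ vertex p (l + d)
      vertex′-> {l} i<l with l ≤? i
      ... | yes l≤i = contradiction l≤i (<⇒≱ i<l)
      ... | no  _   = refl

      end′ : vertex′ k′ ≡ b
      end′ with i <? k′
      ... | yes i<k′ = trans (vertex′-> i<k′) (trans (cong (vertex p) k′+d≡k) (end p))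
      ... | no  i≮k′ = trans (vertex′-≤ k′≤i) (trans (cong (vertex p) k′≡i) (ends i+d≡k))
        where
        k′≤i : k′ ≤ i
        k′≤i = ≮⇒≥ i≮k′
        i+d≡k : i + d ≡ k
        i+d≡k = ≤-antisym i+d≤k (subst (_≤ i + d) k′+d≡k (+-monoˡ-≤ d k′≤i))
        k′≡i : k′ ≡ i
        k′≡i = +-cancelʳ-≡ d k′ i (trans k′+d≡k (sym i+d≡k))

      adjacent′ : ∀ l → l < k′ → vertex′ l ~ vertex′ (suc l)
      adjacent′ l l<k′ with <-cmp l i
      ... | tri< l<i _ _ =
        subst₂ _~_ (sym (vertex′-≤ (<⇒≤ l<i))) (sym (vertex′-≤ l<i)) (adjacent p l (<-trans l<i i<k))
      ... | tri≈ _ refl _ =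
        subst₂ _~_ (sym (vertex′-≤ ≤-refl)) (sym (vertex′-> (n<1+n l))) (link (shift-< l<k′))
      ... | tri> _ _ i<l =
        subst₂ _~_ (sym (vertex′-> i<l)) (sym (vertex′-> (<-trans i<l (n<1+n l))))
               (adjacent p (l + d) (shift-< l<k′))

      interior′ : ∀ l → 0 < l → l < k′ → P (vertex′ l)
      interior′ l 0<l l<k′ with l ≤? i
      ... | yes l≤i = interior p l 0<l (≤-<-trans l≤i i<k)
      ... | no  _   = interior p (l + d) (≤-trans 0<l (m≤m+n l d)) (shift-< l<k′)

      path : Path P a b
      path = record
        { length = k′ ; vertex = vertex′ ; start = trans (vertex′-≤ z≤n) (start p) ; end = end′
        ; adjacent = adjacent′ ; interior = interior′ }

      shorter : length path < length p
      shorter = subst (k′ <_) k′+d≡k (m<m+n k′ 0<d)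

    ChordAt : ∀ {a b} → Path P a b → ℕ → ℕ → Set
    ChordAt p i j = suc i < j × j ≤ length p × Shortcut (vertex p i) (vertex p j)

    chord? : ∀ {a b} (p : Path P a b) → Dec (∃₂ (ChordAt p))
    chord? p =
      map′ (λ (j , j<1+k , i , _ , 1+i<j , sc) → i , j , 1+i<j , ≤-pred j<1+k , sc)
           (λ (i , j , 1+i<j , j≤k , sc) → j , s≤s j≤k , i , <-trans (n<1+n i) 1+i<j , 1+i<j , sc)
           (anyUpTo? (λ j → anyUpTo? (λ i → (suc i <? j) ×-dec shortcut? i j) j) (suc (length p)))
      where
      shortcut? : ∀ i j → Dec (Shortcut (vertex p i) (vertex p j))
      shortcut? i j = (vertex p i ≟ᶠ vertex p j) ⊎-dec (vertex p i ~? vertex p j)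

    -- A chord vertex i ~ vertex j skips the vertices strictly between i and j;
    -- a repetition vertex i ≡ vertex j also skips vertex j.
    bypass-chord : ∀ {a b} (p : Path P a b) {i j} → ChordAt p i j →
                   Σ[ q ∈ Path P a b ] length q < length p
    bypass-chord {b = b} p {i} {j} (1+i<j , j≤k , inj₂ pi~pj) =
      B.path , B.shorter
      where
      d : ℕ
      d = j ∸ suc i
      1+i+d≡j : suc (i + d) ≡ j
      1+i+d≡j = m+[n∸m]≡n (<⇒≤ 1+i<j)
      i+d<k : i + d < length p
      i+d<k = subst (_≤ length p) (sym 1+i+d≡j) j≤k
      link : i + d < length p → vertex p i ~ vertex p (suc (i + d))
      link _ = subst (λ l → vertex p i ~ vertex p l) (sym 1+i+d≡j) pi~pj
      ends : i + d ≡ length p → vertex p i ≡ b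
      ends i+d≡k = contradiction i+d≡k (<⇒≢ i+d<k)
      module B = Bypass p i d (m<n⇒0<n∸m 1+i<j) (<⇒≤ i+d<k) link ends
    bypass-chord {b = b} p {i} {j} (1+i<j , j≤k , inj₁ pi≡pj) =
      B.path , B.shorter
      where
      i<j : i < j
      i<j = <-trans (n<1+n i) 1+i<j
      d : ℕ
      d = j ∸ i
      i+d≡j : i + d ≡ j
      i+d≡j = m+[n∸m]≡n (<⇒≤ i<j)
      i+d≤k : i + d ≤ length p
      i+d≤k = subst (_≤ length p) (sym i+d≡j) j≤k
      link : i + d < length p → vertex p i ~ vertex p (suc (i + d))
      link i+d<k rewrite i+d≡j =
        subst (_~ vertex p (suc j)) (sym pi≡pj) (adjacent p j i+d<k)
      ends : i + d ≡ length p → vertex p i ≡ b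
      ends i+d≡k = trans pi≡pj (trans (cong (vertex p) (trans (sym i+d≡j) i+d≡k)) (end p))
      module B = Bypass p i d (m<n⇒0<n∸m i<j) i+d≤k link ends

    chordless-path : ∀ {a b} → Path P a b → Σ[ q ∈ Path P a b ] Chordless q
    chordless-path p = go p (<-wellFounded (length p))
      where
      go : ∀ {a b} (p : Path P a b) → Acc _<_ (length p) → Σ[ q ∈ Path P a b ] Chordless q
      go p (acc rec) with chord? p
      ... | yes (_ , _ , chord) = let q , q<p = bypass-chord p chord in go q (rec q<p)
      ... | no ∄chord = p , λ i j 1+i<j j≤k sc → ∄chord (i , j , 1+i<j , j≤k , sc)

suc-mod : ∀ {N} .{{_ : NonZero N}} {t} → t < N →
          (suc t < N × suc t % N ≡ suc t) ⊎ (suc t ≡ N × suc t % N ≡ 0)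
suc-mod {N} t<N with m≤n⇒m<n∨m≡n t<N
... | inj₁ 1+t<N = inj₁ (1+t<N , m<n⇒m%n≡m 1+t<N)
... | inj₂ 1+t≡N = inj₂ (1+t≡N , trans (cong (_% N) 1+t≡N) (n%n≡0 N))

CycleStep : ℕ → ℕ → ℕ → Set
CycleStep N i j = j ≡ suc i ⊎ (i ≡ 0 × suc j ≡ N)

cycConsec-< : ∀ {N} .{{_ : NonZero N}} (i j : Fin N) → toℕ i < toℕ j →
              CycConsec N i j ⇔ CycleStep N (toℕ i) (toℕ j)
cycConsec-< {N} i j i<j = mk⇔ to from
  where
  1+i%N≡1+i : suc (toℕ i) % N ≡ suc (toℕ i)
  1+i%N≡1+i = m<n⇒m%n≡m (<-≤-trans (s≤s i<j) (toℕ<n j))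
  to : CycConsec N i j → CycleStep N (toℕ i) (toℕ j)
  to (inj₁ 1+i%N≡j) = inj₁ (trans (sym 1+i%N≡j) 1+i%N≡1+i)
  to (inj₂ 1+j%N≡i) with suc-mod (toℕ<n j)
  ... | inj₁ (_ , 1+j%N≡1+j) =
    contradiction (trans (sym 1+j%N≡1+j) 1+j%N≡i) (>⇒≢ (<-trans i<j (n<1+n _)))
  ... | inj₂ (1+j≡N , 1+j%N≡0) = inj₂ (trans (sym 1+j%N≡i) 1+j%N≡0 , 1+j≡N)
  from : CycleStep N (toℕ i) (toℕ j) → CycConsec N i j
  from (inj₁ j≡1+i) = inj₁ (trans 1+i%N≡1+i (sym j≡1+i))
  from (inj₂ (i≡0 , 1+j≡N)) = inj₂ (trans (cong (_% N) 1+j≡N) (trans (n%n≡0 N) (sym i≡0)))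

¬cycConsec-refl : ∀ {M} (i : Fin (suc (suc M))) → ¬ CycConsec (suc (suc M)) i i
¬cycConsec-refl {M} i c with suc-mod (toℕ<n i) | reduce c
... | inj₁ (_ , 1+i%N≡1+i)  | 1+i%N≡i = 1+n≢n (trans (sym 1+i%N≡1+i) 1+i%N≡i)
... | inj₂ (1+i≡N , 1+i%N≡0) | 1+i%N≡i =
  contradiction (subst (λ t → suc t ≡ suc (suc M)) (trans (sym 1+i%N≡i) 1+i%N≡0) 1+i≡N) λ ()

module InducedCycles {n : ℕ} (G : Graph n) where

  open Adjacency G

  sequence⇒induced-cycle : ∀ m (q : ℕ → Fin n) →
    (∀ {i j} → i < j → j < 4 + m → q i ≢ q j) →
    (∀ {i j} → i < j → j < 4 + m → q i ~ q j ⇔ CycleStep (4 + m) i j) →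
    IsInducedCycle G m (λ i → q (toℕ i))
  sequence⇒induced-cycle m q distinct step⇔ = injective , inV , adjacent⇔consecutive
    where
    c : Fin (4 + m) → Fin n
    c i = q (toℕ i)

    injective : ∀ {i j} → c i ≡ c j → i ≡ j
    injective {i} {j} ci≡cj with <-cmp (toℕ i) (toℕ j)
    ... | tri< i<j _ _ = contradiction ci≡cj (distinct i<j (toℕ<n j))
    ... | tri≈ _ i≡j _ = toℕ-injective i≡j
    ... | tri> _ _ j<i = contradiction (sym ci≡cj) (distinct j<i (toℕ<n i))

    inV : ∀ i → V G (c i) ≡ true
    inV i with m≤n⇒m<n∨m≡n (toℕ<n i)
    ... | inj₁ 1+i<N = ~⇒∈V (Equivalence.from (step⇔ (n<1+n _) 1+i<N) (inj₁ refl))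
    ... | inj₂ 1+i≡N = ~⇒∈V (~-sym (Equivalence.from (step⇔ 0<i (toℕ<n i)) (inj₂ (refl , 1+i≡N))))
      where
      0<i : 0 < toℕ i
      0<i = subst (0 <_) (sym (suc-injective 1+i≡N)) (s≤s z≤n)

    forward⇔ : ∀ i j → toℕ i < toℕ j → c i ~ c j ⇔ CycConsec (4 + m) i j
    forward⇔ i j i<j = ⇔.trans (step⇔ i<j (toℕ<n j)) (⇔.sym (cycConsec-< i j i<j))

    adjacent⇔consecutive : ∀ i j → c i ~ c j ⇔ CycConsec (4 + m) i j
    adjacent⇔consecutive i j with <-cmp (toℕ i) (toℕ j)
    ... | tri< i<j _ _ = forward⇔ i j i<j
    ... | tri> _ _ j<i = ⇔.trans (mk⇔ ~-sym ~-sym) (⇔.trans (forward⇔ j i j<i) (mk⇔ swap swap))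
    ... | tri≈ _ i≡j _ rewrite toℕ-injective {i = i} {j} i≡j =
      mk⇔ (λ ci~ci → contradiction ci~ci ~-irrefl) (λ cc → contradiction cc (¬cycConsec-refl j))

endpoint-or-interior : ∀ {t k} → t ≤ k → t ≡ 0 ⊎ t ≡ k ⊎ (0 < t × t < k)
endpoint-or-interior {zero}  _   = inj₁ refl
endpoint-or-interior {suc t} t≤k with m≤n⇒m<n∨m≡n t≤k
... | inj₁ t<k = inj₂ (inj₂ (s≤s z≤n , t<k))
... | inj₂ t≡k = inj₂ (inj₁ t≡k)

module Chordality {n : ℕ} (G : Graph n) where

  open Adjacency G
  open Paths G
  open InducedCycles G

  infix 4 _∉N[_]

  _∉N[_] : Fin n → Fin n → Set
  v ∉N[ x ] = v ≢ x × x ≁ v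

  chordless-detour⇒induced-cycle : ∀ {x a b} m (p : Path (_∉N[ x ]) a b) → length p ≡ 2 + m →
    Chordless p → x ~ a → x ~ b → ∃[ c ] IsInducedCycle G m c
  chordless-detour⇒induced-cycle {x} {a} {b} m p len chordless x~a x~b =
    _ , sequence⇒induced-cycle m q distinct step⇔
    where
    q : ℕ → Fin n
    q zero    = x
    q (suc t) = vertex p t

    on-path : ∀ {t} → suc t < 4 + m → t ≤ length p
    on-path 1+t<N = subst (_ ≤_) (sym len) (≤-pred (≤-pred 1+t<N))

    distinct : ∀ {i j} → i < j → j < 4 + m → q i ≢ q j
    distinct {zero} {suc t} _ 1+t<N x≡pt with endpoint-or-interior (on-path 1+t<N)
    ... | inj₁ t≡0 = ~⇒≢ x~a (trans x≡pt (trans (cong (vertex p) t≡0) (start p)))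
    ... | inj₂ (inj₁ t≡k) = ~⇒≢ x~b (trans x≡pt (trans (cong (vertex p) t≡k) (end p)))
    ... | inj₂ (inj₂ (0<t , t<k)) = proj₁ (interior p t 0<t t<k) (sym x≡pt)
    distinct {suc s} {suc t} (s≤s s<t) 1+t<N ps≡pt with m≤n⇒m<n∨m≡n s<t
    ... | inj₁ 1+s<t = chordless s t 1+s<t (on-path 1+t<N) (inj₁ ps≡pt)
    ... | inj₂ 1+s≡t = ~⇒≢ (adjacent p s (<-≤-trans s<t (on-path 1+t<N)))
                           (trans ps≡pt (cong (vertex p) (sym 1+s≡t)))

    step⇔ : ∀ {i j} → i < j → j < 4 + m → q i ~ q j ⇔ CycleStep (4 + m) i j
    step⇔ {zero} {suc t} _ 1+t<N = mk⇔ to from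
      where
      to : x ~ vertex p t → CycleStep (4 + m) 0 (suc t)
      to x~pt with endpoint-or-interior (on-path 1+t<N)
      ... | inj₁ t≡0 = inj₁ (cong suc t≡0)
      ... | inj₂ (inj₁ t≡k) = inj₂ (refl , cong (λ l → suc (suc l)) (trans t≡k len))
      ... | inj₂ (inj₂ (0<t , t<k)) = contradiction x~pt (≁⇒¬~ (proj₂ (interior p t 0<t t<k)))
      from : CycleStep (4 + m) 0 (suc t) → x ~ vertex p t
      from (inj₁ 1+t≡1) =
        subst (x ~_) (sym (trans (cong (vertex p) (suc-injective 1+t≡1)) (start p))) x~a
      from (inj₂ (_ , 2+t≡N)) =
        subst (x ~_) (sym (trans (cong (vertex p) t≡k) (end p))) x~b
        where
        t≡k : t ≡ length p
        t≡k = trans (suc-injective (suc-injective 2+t≡N)) (sym len)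
    step⇔ {suc s} {suc t} (s≤s s<t) 1+t<N = mk⇔ to from
      where
      to : vertex p s ~ vertex p t → CycleStep (4 + m) (suc s) (suc t)
      to ps~pt with m≤n⇒m<n∨m≡n s<t
      ... | inj₁ 1+s<t = contradiction (inj₂ ps~pt) (chordless s t 1+s<t (on-path 1+t<N))
      ... | inj₂ 1+s≡t = inj₁ (cong suc (sym 1+s≡t))
      from : CycleStep (4 + m) (suc s) (suc t) → vertex p s ~ vertex p t
      from (inj₁ 1+t≡2+s) = subst (λ l → vertex p s ~ vertex p l) (sym (suc-injective 1+t≡2+s))
                                  (adjacent p s (<-≤-trans s<t (on-path 1+t<N)))

  no-detour : Chordal G → ∀ {x a b} → x ~ a → x ~ b → a ≁ b → a ≢ b → ¬ Path (_∉N[ x ]) a b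
  no-detour chordal {x} {a} {b} x~a x~b a≁b a≢b p =
    let q , chordless = chordless-path p in by-length q chordless (length q) refl
    where
    by-length : (q : Path (_∉N[ x ]) a b) → Chordless q → ∀ k → length q ≡ k → ⊥
    by-length q _ zero len = a≢b (trans (sym (start q)) (trans (cong (vertex q) (sym len)) (end q)))
    by-length q _ (suc zero) len =
      ≁⇒¬~ a≁b (subst₂ _~_ (start q) (trans (cong (vertex q) (sym len)) (end q))
                       (adjacent q 0 (subst (0 <_) (sym len) (s≤s z≤n))))
    by-length q chordless (suc (suc m)) len =
      let c , cycle = chordless-detour⇒induced-cycle m q len chordless x~a x~b in chordal m c cycle

-- Dirac's lemma

module Components {n : ℕ} (G : Graph n) where

  open Adjacency G

  record Component (W : Subset n) (y : Fin n) : Set where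
    field
      members   : Subset n
      root      : y ∈ members
      ⊆W        : members ⊆ W
      closed    : ∀ {u v} → u ∈ members → v ∈ W → u ~ v → v ∈ members
      connected : ∀ {v} → v ∈ members → Star _~[ W ]_ y v

  component : ∀ {W y} → y ∈ W → Component W y
  component {W} {y} y∈W = grow ⁅ y ⁆ (⊃-wellFounded _) (x∈⁅x⁆ y) ⁅y⁆⊆W ⁅y⁆-connected
    where
    ⁅y⁆⊆W : ⁅ y ⁆ ⊆ W
    ⁅y⁆⊆W v∈⁅y⁆ = subst (_∈ W) (sym (x∈⁅y⁆⇒x≡y y v∈⁅y⁆)) y∈W

    ⁅y⁆-connected : ∀ {v} → v ∈ ⁅ y ⁆ → Star _~[ W ]_ y v
    ⁅y⁆-connected v∈⁅y⁆ rewrite x∈⁅y⁆⇒x≡y y v∈⁅y⁆ = ε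

    grow : ∀ C → Acc _⊃_ C → y ∈ C → C ⊆ W → (∀ {v} → v ∈ C → Star _~[ W ]_ y v) → Component W y
    grow C (acc rec) y∈C C⊆W conn
      with any? (λ u → any? (λ v → (u ∈? C) ×-dec (v ∈? W) ×-dec ¬? (v ∈? C) ×-dec (u ~? v)))
    ... | no ∄edge = record
      { members = C ; root = y∈C ; ⊆W = C⊆W ; connected = conn
      ; closed = λ {u} {v} u∈C v∈W u~v →
          decidable-stable (v ∈? C) (λ v∉C → ∄edge (u , v , u∈C , v∈W , v∉C , u~v)) }
    ... | yes (u , v , u∈C , v∈W , v∉C , u~v) =
      grow (C ∪ ⁅ v ⁆) (rec C⊂C∪⁅v⁆) (p⊆p∪q _ y∈C) C∪⁅v⁆⊆W conn′
      where
      C⊂C∪⁅v⁆ : C ⊂ C ∪ ⁅ v ⁆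
      C⊂C∪⁅v⁆ = p⊆p∪q _ , v , x∈p∪q⁺ (inj₂ (x∈⁅x⁆ v)) , v∉C
      C∪⁅v⁆⊆W : C ∪ ⁅ v ⁆ ⊆ W
      C∪⁅v⁆⊆W h with x∈p∪q⁻ C _ h
      ... | inj₁ ∈C   = C⊆W ∈C
      ... | inj₂ ∈⁅v⁆ rewrite x∈⁅y⁆⇒x≡y v ∈⁅v⁆ = v∈W
      conn′ : ∀ {z} → z ∈ C ∪ ⁅ v ⁆ → Star _~[ W ]_ y z
      conn′ h with x∈p∪q⁻ C _ h
      ... | inj₁ ∈C   = conn ∈C
      ... | inj₂ ∈⁅v⁆ rewrite x∈⁅y⁆⇒x≡y v ∈⁅v⁆ = conn u∈C ◅◅ ((C⊆W u∈C , v∈W , u~v) ◅ ε)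

module Dirac {n : ℕ} (G : Graph n) (chordal : Chordal G) where

  open Adjacency G
  open Paths G
  open Chordality G
  open Components G

  Clique : Subset n → Set
  Clique U = ∀ {u v} → u ∈ U → v ∈ U → u ≢ v → u ~ v

  SimplicialIn : Subset n → Fin n → Set
  SimplicialIn U s = ∀ {u v} → u ∈ U → v ∈ U → s ~ u → s ~ v → u ≢ v → u ~ v

  clique-or-nonadjacent : ∀ U → Clique U ⊎ ∃₂ λ a b → a ∈ U × b ∈ U × b ∉N[ a ]
  clique-or-nonadjacent U
    with any? (λ a → any? (λ b → (a ∈? U) ×-dec (b ∈? U) ×-dec ¬? (b ≟ᶠ a) ×-dec (E G a b ≟ᵇ false)))
  ... | yes (a , b , a∈U , b∈U , b≢a , a≁b) = inj₂ (a , b , a∈U , b∈U , b≢a , a≁b)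
  ... | no ∄pair = inj₁ λ {u} {v} u∈U v∈U u≢v →
    decidable-stable (u ~? v) λ ¬u~v → ∄pair (u , v , u∈U , v∈U , u≢v ∘′ sym , ¬~⇒≁ ¬u~v)

  SimplicialOutside : Subset n → Fin n → Set
  SimplicialOutside U x = ∃[ s ] (s ∈ U × s ∉N[ x ] × SimplicialIn U s)

  DiracProperty : Subset n → Set
  DiracProperty U = ∀ {x y} → x ∈ U → y ∈ U → y ∉N[ x ] → SimplicialOutside U x

  -- C is the component of y in G[U] - N[x], and U′ = N[C] ∩ U ⊊ U.  The vertices of U′ outside C
  -- are adjacent to x, and pairwise adjacent since otherwise a detour through C would close an
  -- induced cycle with x; so a simplicial vertex of G[U′] can be found in C.
  module Separation {U : Subset n} {x y : Fin n} (x∈U : x ∈ U) (y∈U : y ∈ U) (y∉N[x] : y ∉N[ x ]) where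

    private
      ∈W? : ∀ v → Dec (v ∈ U × v ∉N[ x ])
      ∈W? v = (v ∈? U) ×-dec ¬? (v ≟ᶠ x) ×-dec (E G x v ≟ᵇ false)

    W : Subset n
    W = fromDec ∈W?

    open Component (component (∈-fromDec⁺ ∈W? (y∈U , y∉N[x]))) renaming (members to C)

    private
      ∈U′? : ∀ v → Dec (v ∈ U × (v ∈ C ⊎ ∃[ u ] (u ∈ C × u ~ v)))
      ∈U′? v = (v ∈? U) ×-dec ((v ∈? C) ⊎-dec any? (λ u → (u ∈? C) ×-dec (u ~? v)))

    U′ : Subset n
    U′ = fromDec ∈U′?

    C⊆W : ∀ {v} → v ∈ C → v ∈ U × v ∉N[ x ]
    C⊆W v∈C = ∈-fromDec⁻ ∈W? (⊆W v∈C)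

    N[C]⊆U′ : ∀ {u v} → u ∈ C → v ∈ U → u ~ v → v ∈ U′
    N[C]⊆U′ u∈C v∈U u~v = ∈-fromDec⁺ ∈U′? (v∈U , inj₂ (_ , u∈C , u~v))

    boundary : ∀ {v} → v ∈ U′ → v ∉ C → ∃[ u ] (u ∈ C × u ~ v)
    boundary v∈U′ v∉C with ∈-fromDec⁻ ∈U′? v∈U′
    ... | _ , inj₁ v∈C  = contradiction v∈C v∉C
    ... | _ , inj₂ edge = edge

    x∉U′ : x ∉ U′
    x∉U′ x∈U′ with ∈-fromDec⁻ ∈U′? x∈U′
    ... | _ , inj₁ x∈C = proj₁ (proj₂ (C⊆W x∈C)) refl
    ... | _ , inj₂ (u , u∈C , u~x) = ≁⇒¬~ (proj₂ (proj₂ (C⊆W u∈C))) (~-sym u~x)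

    U′⊂U : U′ ⊂ U
    U′⊂U = (λ v∈U′ → proj₁ (∈-fromDec⁻ ∈U′? v∈U′)) , x , x∈U , x∉U′

    boundary⇒~x : ∀ {v} → v ∈ U′ → v ∉ C → x ~ v
    boundary⇒~x {v} v∈U′ v∉C with boundary v∈U′ v∉C
    ... | u , u∈C , u~v = decidable-stable (x ~? v) λ ¬x~v → v∉C (closed u∈C (v∈W ¬x~v) u~v)
      where
      v≢x : v ≢ x
      v≢x refl = ≁⇒¬~ (proj₂ (proj₂ (C⊆W u∈C))) (~-sym u~v)
      v∈W : ¬ x ~ v → v ∈ W
      v∈W ¬x~v = ∈-fromDec⁺ ∈W? (proj₁ (∈-fromDec⁻ ∈U′? v∈U′) , v≢x , ¬~⇒≁ ¬x~v)

    boundary-clique : ∀ {a b} → a ∈ U′ → a ∉ C → b ∈ U′ → b ∉ C → a ≢ b → a ~ b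
    boundary-clique {a} {b} a∈U′ a∉C b∈U′ b∉C a≢b with boundary a∈U′ a∉C | boundary b∈U′ b∉C
    ... | c , c∈C , c~a | d , d∈C , d~b = decidable-stable (a ~? b) λ ¬a~b →
      no-detour chordal (boundary⇒~x a∈U′ a∉C) (boundary⇒~x b∈U′ b∉C) (¬~⇒≁ ¬a~b) a≢b
        (detour (λ v∈W → proj₂ (∈-fromDec⁻ ∈W? v∈W)) (~-sym c~a) (⊆W c∈C)
                (reverse ~[]-sym (connected c∈C) ◅◅ connected d∈C) d~b)

    lift : ∀ {s} → s ∈ C → SimplicialIn U′ s → SimplicialOutside U x
    lift s∈C simp = _ , proj₁ (C⊆W s∈C) , proj₂ (C⊆W s∈C) ,
      λ u∈U v∈U s~u s~v → simp (N[C]⊆U′ s∈C u∈U s~u) (N[C]⊆U′ s∈C v∈U s~v) s~u s~v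

    from-boundary : DiracProperty U′ →
                    ∀ {a b} → a ∉ C → a ∈ U′ → b ∈ U′ → b ∉N[ a ] → SimplicialOutside U x
    from-boundary IH a∉C a∈U′ b∈U′ b∉N[a] with IH a∈U′ b∈U′ b∉N[a]
    ... | s , s∈U′ , (s≢a , a≁s) , simp with s ∈? C
    ...   | yes s∈C = lift s∈C simp
    ...   | no s∉C = contradiction (boundary-clique a∈U′ a∉C s∈U′ s∉C (s≢a ∘′ sym)) (≁⇒¬~ a≁s)

    simplicial-outside : DiracProperty U′ → SimplicialOutside U x
    simplicial-outside IH with clique-or-nonadjacent U′
    ... | inj₁ clique = y , y∈U , y∉N[x] , λ u∈U v∈U y~u y~v →
      clique (N[C]⊆U′ root u∈U y~u) (N[C]⊆U′ root v∈U y~v)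
    ... | inj₂ (a , b , a∈U′ , b∈U′ , b∉N[a]) with a ∈? C
    ...   | no a∉C = from-boundary IH a∉C a∈U′ b∈U′ b∉N[a]
    ...   | yes _ with IH a∈U′ b∈U′ b∉N[a]
    ...     | s , s∈U′ , (s≢a , a≁s) , simp with s ∈? C
    ...       | yes s∈C = lift s∈C simp
    ...       | no s∉C = from-boundary IH s∉C s∈U′ a∈U′ ((λ a≡s → s≢a (sym a≡s)) , ≁-sym a≁s)

  dirac : ∀ U → DiracProperty U
  dirac U = go U (⊂-wellFounded U)
    where
    go : ∀ U → Acc _⊂_ U → DiracProperty U
    go U (acc rec) x∈U y∈U y∉N[x] = simplicial-outside (go U′ (rec U′⊂U))
      where open Separation x∈U y∈U y∉N[x]

  Simplicial : Fin n → Set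
  Simplicial s = ∀ {u v} → s ~ u → s ~ v → u ≢ v → u ~ v

  simplicial-non-isolated : HasEdge G → ∃[ s ] (NonIsolated G s × Simplicial s)
  simplicial-non-isolated (a , b , a~b) = choose (clique-or-nonadjacent U)
    where
    non-isolated? : ∀ v → Dec (NonIsolated G v)
    non-isolated? v = any? (v ~?_)

    U : Subset n
    U = fromDec non-isolated?

    N⊆U : ∀ {s u} → s ~ u → u ∈ U
    N⊆U {s} s~u = ∈-fromDec⁺ non-isolated? (s , ~-sym s~u)

    choose : Clique U ⊎ ∃₂ (λ x y → x ∈ U × y ∈ U × y ∉N[ x ]) → ∃[ s ] (NonIsolated G s × Simplicial s)
    choose (inj₁ clique) = a , (b , a~b) , λ a~u a~v → clique (N⊆U a~u) (N⊆U a~v)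
    choose (inj₂ (x , y , x∈U , y∈U , y∉N[x])) =
      let s , s∈U , _ , simp = dirac U x∈U y∈U y∉N[x]
      in s , ∈-fromDec⁻ non-isolated? s∈U , λ s~u s~v → simp (N⊆U s~u) (N⊆U s~v) s~u s~v

  simplicial⇒N⊆N[] : ∀ {s w} → Simplicial s → s ~ w → ∀ {u} → s ~ u → u ≡ w ⊎ w ~ u
  simplicial⇒N⊆N[] {w = w} simplicial s~w {u} s~u with u ≟ᶠ w
  ... | yes u≡w = inj₁ u≡w
  ... | no u≢w  = inj₂ (simplicial s~w s~u λ w≡u → u≢w (sym w≡u))

-- Collapsing a cone

module ConeCollapse {n : ℕ} {w s : Fin n} (w≢s : w ≢ s) where

  record StarIsCone (Y : Complex n) : Set where
    field
      faces? : ∀ ρ → Dec (Y ρ)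
      add    : ∀ {ρ} → Y ρ → w ∈ ρ → Y (ρ ∪ ⁅ s ⁆)
      remove : ∀ {ρ} → Y ρ → w ∈ ρ → Y (ρ - s)

    star-size : ℕ
    star-size = count (λ ρ → faces? ρ ×-dec (w ∈? ρ))

  open StarIsCone

  module FreeFace {Y : Complex n} (cone : StarIsCone Y) {σ : Subset n}
                  (Yσ : Y σ) (w∈σ : w ∈ σ) (s∉σ : s ∉ σ)
                  (maximal : ∀ ρ → Y ρ × w ∈ ρ × s ∉ ρ → σ ⊆ ρ → ρ ≡ σ) where

    collapsed : Complex n
    collapsed ρ = Y ρ × ¬ σ ⊆ ρ

    free : IsFreePair Y σ (σ ∪ ⁅ s ⁆)
    free = Yσ , add cone Yσ w∈σ , p⊆p∪q ⁅ s ⁆ , σ≢σ∪⁅s⁆ , cofaces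
      where
      σ≢σ∪⁅s⁆ : σ ≢ σ ∪ ⁅ s ⁆
      σ≢σ∪⁅s⁆ σ≡ = s∉σ (subst (s ∈_) (sym σ≡) (x∈p∪q⁺ (inj₂ (x∈⁅x⁆ s))))
      cofaces : ∀ ρ → Y ρ → σ ⊆ ρ → ρ ≡ σ ⊎ ρ ≡ σ ∪ ⁅ s ⁆
      cofaces ρ Yρ σ⊆ρ = by-s (s ∈? ρ)
        where
        σ⊆ρ-s : σ ⊆ ρ - s
        σ⊆ρ-s x∈σ = x∈p∧x≢y⇒x∈p-y (σ⊆ρ x∈σ) λ { refl → s∉σ x∈σ }
        ρ-s≡σ : ρ - s ≡ σ
        ρ-s≡σ = maximal (ρ - s) (remove cone Yρ w∈ρ , x∈p∧x≢y⇒x∈p-y w∈ρ w≢s , y∉p-y ρ s) σ⊆ρ-s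
          where w∈ρ = σ⊆ρ w∈σ
        by-s : Dec (s ∈ ρ) → ρ ≡ σ ⊎ ρ ≡ σ ∪ ⁅ s ⁆
        by-s (no s∉ρ)  = inj₁ (trans (sym (p-y≡p s∉ρ)) ρ-s≡σ)
        by-s (yes s∈ρ) = inj₂ (trans (sym ([p-y]∪⁅y⁆≡p s∈ρ)) (cong (_∪ ⁅ s ⁆) ρ-s≡σ))

    collapsed-cone : StarIsCone collapsed
    collapsed-cone = record
      { faces? = λ ρ → faces? cone ρ ×-dec ¬? (σ ⊆? ρ)
      ; add    = λ (Yρ , σ⊈ρ) w∈ρ → add cone Yρ w∈ρ , λ σ⊆ρ∪⁅s⁆ → σ⊈ρ (λ x∈σ → back x∈σ (σ⊆ρ∪⁅s⁆ x∈σ))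
      ; remove = λ (Yρ , σ⊈ρ) w∈ρ → remove cone Yρ w∈ρ , λ σ⊆ρ-s → σ⊈ρ (p─q⊆p _ ⁅ s ⁆ ∘ σ⊆ρ-s)
      }
      where
      back : ∀ {ρ x} → x ∈ σ → x ∈ ρ ∪ ⁅ s ⁆ → x ∈ ρ
      back {ρ} x∈σ x∈ρ∪⁅s⁆ with x∈p∪q⁻ ρ ⁅ s ⁆ x∈ρ∪⁅s⁆
      ... | inj₁ x∈ρ   = x∈ρ
      ... | inj₂ x∈⁅s⁆ rewrite x∈⁅y⁆⇒x≡y s x∈⁅s⁆ = contradiction x∈σ s∉σ

    smaller : star-size collapsed-cone < star-size cone
    smaller = count-< (λ ρ → faces? collapsed-cone ρ ×-dec (w ∈? ρ)) (λ ρ → faces? cone ρ ×-dec (w ∈? ρ))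
                      (λ ((Yρ , _) , w∈ρ) → Yρ , w∈ρ) (Yσ , w∈σ) (λ ((_ , σ⊈σ) , _) → σ⊈σ (λ x∈σ → x∈σ))

  -- A ⊆-maximal face σ with w ∈ σ and s ∉ σ is free with coface σ ∪ {s}; removing the faces
  -- containing σ keeps the star of w a cone and shrinks it.
  collapses-onto-deletion : ∀ {Y T} → StarIsCone Y → (∀ ρ → T ρ ⇔ (Y ρ × w ∉ ρ)) → Collapses Y T
  collapses-onto-deletion cone T⇔ = go cone T⇔ (<-wellFounded _)
    where
    go : ∀ {Y T} (cone : StarIsCone Y) → (∀ ρ → T ρ ⇔ (Y ρ × w ∉ ρ)) →
         Acc _<_ (star-size cone) → Collapses Y T
    go {Y} {T} cone T⇔ (acc rec) with anySubset? (λ ρ → faces? cone ρ ×-dec (w ∈? ρ) ×-dec ¬? (s ∈? ρ))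
    ... | no ∄open = done λ ρ → ⇔.sym (⇔.trans (T⇔ ρ) (mk⇔ proj₁ λ Yρ → Yρ , avoids Yρ))
      where
      avoids : ∀ {ρ} → Y ρ → w ∉ ρ
      avoids Yρ w∈ρ = ∄open (_ , remove cone Yρ w∈ρ , x∈p∧x≢y⇒x∈p-y w∈ρ w≢s , y∉p-y _ s)
    ... | yes (_ , open₀) with ⊆-maximal (λ ρ → faces? cone ρ ×-dec (w ∈? ρ) ×-dec ¬? (s ∈? ρ)) open₀
    ...   | σ , (Yσ , w∈σ , s∉σ) , _ , maximal =
      step (σ , σ ∪ ⁅ s ⁆ , free , λ _ → ⇔.refl)
           (go collapsed-cone T⇔′ (rec smaller))
      where
      open FreeFace cone Yσ w∈σ s∉σ maximal
      T⇔′ : ∀ ρ → T ρ ⇔ (collapsed ρ × w ∉ ρ)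
      T⇔′ ρ = ⇔.trans (T⇔ ρ) (mk⇔ (λ (Yρ , w∉ρ) → (Yρ , λ σ⊆ρ → w∉ρ (σ⊆ρ w∈σ)) , w∉ρ)
                                  (λ ((Yρ , _) , w∉ρ) → Yρ , w∉ρ))

-- Deleting a dominated vertex

module _ {n : ℕ} (G : Graph n) where

  independent? : ∀ S → Dec (IsIndependent G S)
  independent? S = all? (λ u → (u ∈? S) →-dec (V G u ≟ᵇ true))
             ×-dec all? (λ u → all? (λ v → (u ∈? S) →-dec ((v ∈? S) →-dec (E G u v ≟ᵇ false))))

  independence-number : ∃[ k ] IsIndepNumber G k
  independence-number =
    let S , indS , max = maximum independent? {∅} ((λ _ → ⊥-elim ∘ ∉⊥) , λ _ _ → ⊥-elim ∘ ∉⊥)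
    in ∣ S ∣ , (S , indS , refl) , max

  module _ (w : Fin n) where

    independent-─v⁻ : ∀ {T} → IsIndependent (G ─v w) T → IsIndependent G T
    independent-─v⁻ (inV , indep) =
      (λ u u∈T → proj₁ (─v-V⁻ G w (inV u u∈T))) ,
      (λ u v u∈T v∈T → ─v-nonadj⁻ G w (indep u v u∈T v∈T) (proj₂ (─v-V⁻ G w (inV u u∈T)))
                                                          (proj₂ (─v-V⁻ G w (inV v v∈T))))

    independent-─v⁺ : ∀ {T} → IsIndependent G T → w ∉ T → IsIndependent (G ─v w) T
    independent-─v⁺ (inV , indep) w∉T =
      (λ u u∈T → ─v-V⁺ G w (inV u u∈T) λ { refl → w∉T u∈T }) ,
      (λ u v u∈T v∈T → ─v-nonadj⁺ G w (indep u v u∈T v∈T))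

module DominatedDeletion {n : ℕ} (G : Graph n) {s w : Fin n} (s~w : E G s w ≡ true)
                         (N[s]⊆N[w] : ∀ {u} → E G s u ≡ true → u ≡ w ⊎ E G w u ≡ true) where

  open Adjacency G

  s≢w : s ≢ w
  s≢w = ~⇒≢ s~w

  w≁⇒s≁ : ∀ {u} → u ≢ w → w ≁ u → s ≁ u
  w≁⇒s≁ u≢w w≁u = ¬~⇒≁ λ s~u → [ u≢w , ≁⇒¬~ w≁u ]′ (N[s]⊆N[w] s~u)

  exchange : ∀ {S} → IsIndependent G S → w ∈ S → ∃[ T ] (IsIndependent (G ─v w) T × ∣ S ∣ ≤ ∣ T ∣)
  exchange {S} (inV , indep) w∈S = T , independent-─v⁺ G w (T-inV , T-indep) w∉T , ∣S∣≤∣T∣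
    where
    T : Subset n
    T = (S - w) ∪ ⁅ s ⁆

    Member : Fin n → Set
    Member x = (x ∈ S × x ≢ w) ⊎ x ≡ s

    member : ∀ {x} → x ∈ T → Member x
    member {x} x∈T with x∈p∪q⁻ (S - w) ⁅ s ⁆ x∈T
    ... | inj₁ x∈S-w = inj₁ (p─q⊆p S ⁅ w ⁆ x∈S-w , λ { refl → y∉p-y S w x∈S-w })
    ... | inj₂ x∈⁅s⁆ = inj₂ (x∈⁅y⁆⇒x≡y s x∈⁅s⁆)

    s≁S : ∀ {v} → v ∈ S → v ≢ w → s ≁ v
    s≁S v∈S v≢w = w≁⇒s≁ v≢w (indep w _ w∈S v∈S)

    T-inV : ∀ u → u ∈ T → V G u ≡ true
    T-inV u u∈T with member u∈T
    ... | inj₁ (u∈S , _) = inV u u∈S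
    ... | inj₂ refl      = ~⇒∈V s~w

    nonadjacent : ∀ {u v} → Member u → Member v → u ≁ v
    nonadjacent (inj₁ (u∈S , _)) (inj₁ (v∈S , _))   = indep _ _ u∈S v∈S
    nonadjacent (inj₁ (u∈S , u≢w)) (inj₂ refl)      = ≁-sym (s≁S u∈S u≢w)
    nonadjacent (inj₂ refl) (inj₁ (v∈S , v≢w))      = s≁S v∈S v≢w
    nonadjacent {u} (inj₂ refl) (inj₂ refl)         = E-irr G u

    T-indep : ∀ u v → u ∈ T → v ∈ T → u ≁ v
    T-indep u v u∈T v∈T = nonadjacent (member u∈T) (member v∈T)

    w∉T : w ∉ T
    w∉T w∈T with member w∈T
    ... | inj₁ (_ , w≢w) = w≢w refl
    ... | inj₂ w≡s       = s≢w (sym w≡s)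

    s∉S-w : s ∉ S - w
    s∉S-w s∈S-w = ≁⇒¬~ (indep s w (p─q⊆p S ⁅ w ⁆ s∈S-w) w∈S) s~w

    ∣S∣≤∣T∣ : ∣ S ∣ ≤ ∣ T ∣
    ∣S∣≤∣T∣ = ≤-trans (∣p∣≤1+∣p-x∣ S w) (p⊂q⇒∣p∣<∣q∣ (p⊆p∪q ⁅ s ⁆ , s , x∈p∪q⁺ (inj₂ (x∈⁅x⁆ s)) , s∉S-w))

  independence-number-─v : ∀ {k} → IsIndepNumber G k → IsIndepNumber (G ─v w) k
  independence-number-─v {k} ((S , indS , ∣S∣≡k) , max) =
    witness (w ∈? S) , λ T → max T ∘ independent-─v⁻ G w
    where
    attains : ∀ {T} → IsIndependent (G ─v w) T → k ≤ ∣ T ∣ →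
              ∃[ T ] (IsIndependent (G ─v w) T × ∣ T ∣ ≡ k)
    attains {T} indT k≤∣T∣ = T , indT , ≤-antisym (max T (independent-─v⁻ G w indT)) k≤∣T∣
    witness : Dec (w ∈ S) → ∃[ T ] (IsIndependent (G ─v w) T × ∣ T ∣ ≡ k)
    witness (no w∉S) = attains (independent-─v⁺ G w indS w∉S) (≤-reflexive (sym ∣S∣≡k))
    witness (yes w∈S) =
      let T , indT , ∣S∣≤∣T∣ = exchange indS w∈S in attains indT (subst (_≤ ∣ T ∣) ∣S∣≡k ∣S∣≤∣T∣)

  open ConeCollapse {w = w} {s} (λ w≡s → s≢w (sym w≡s))

  nbhd-cone : StarIsCone (NbhdComplex (complement G))
  nbhd-cone = record { faces? = faces? ; add = add ; remove = remove }
    where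
    faces? : ∀ ρ → Dec (NbhdComplex (complement G) ρ)
    faces? ρ = nonempty? ρ ×-dec any? (λ v → (V G v ≟ᵇ true) ×-dec
                                      all? (λ u → (u ∈? ρ) →-dec (E (complement G) v u ≟ᵇ true)))

    add : ∀ {ρ} → NbhdComplex (complement G) ρ → w ∈ ρ → NbhdComplex (complement G) (ρ ∪ ⁅ s ⁆)
    add {ρ} (_ , v , Vv , ρ⊆N[v]) w∈ρ = (s , x∈p∪q⁺ (inj₂ (x∈⁅x⁆ s))) , v , Vv , ρ∪⁅s⁆⊆N[v]
      where
      ρ∪⁅s⁆⊆N[v] : ∀ u → u ∈ ρ ∪ ⁅ s ⁆ → E (complement G) v u ≡ true
      ρ∪⁅s⁆⊆N[v] u u∈ with x∈p∪q⁻ ρ ⁅ s ⁆ u∈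
      ... | inj₁ u∈ρ   = ρ⊆N[v] u u∈ρ
      ... | inj₂ u∈⁅s⁆ rewrite x∈⁅y⁆⇒x≡y s u∈⁅s⁆ with complement-adj⁻ G (ρ⊆N[v] w w∈ρ)
      ...   | _ , _ , v≢w , v≁w =
        complement-adj⁺ G Vv (~⇒∈V s~w) (λ { refl → ≁⇒¬~ v≁w s~w }) (≁-sym (w≁⇒s≁ v≢w (≁-sym v≁w)))

    remove : ∀ {ρ} → NbhdComplex (complement G) ρ → w ∈ ρ → NbhdComplex (complement G) (ρ - s)
    remove {ρ} (_ , v , Vv , ρ⊆N[v]) w∈ρ =
      (w , x∈p∧x≢y⇒x∈p-y w∈ρ λ w≡s → s≢w (sym w≡s)) , v , Vv , λ u u∈ρ-s → ρ⊆N[v] u (p─q⊆p ρ ⁅ s ⁆ u∈ρ-s)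

  nbhd-─v⇔ : ∀ ρ → NbhdComplex (complement (G ─v w)) ρ ⇔ (NbhdComplex (complement G) ρ × w ∉ ρ)
  nbhd-─v⇔ ρ = mk⇔ to from
    where
    to : NbhdComplex (complement (G ─v w)) ρ → NbhdComplex (complement G) ρ × w ∉ ρ
    to (ne , v , Vv , ρ⊆N[v]) =
      (ne , v , proj₁ (─v-V⁻ G w Vv) , λ u u∈ρ → proj₁ (complement-─v-adj⁻ G w (ρ⊆N[v] u u∈ρ))) ,
      λ w∈ρ → proj₂ (proj₂ (complement-─v-adj⁻ G w (ρ⊆N[v] w w∈ρ))) refl

    from : NbhdComplex (complement G) ρ × w ∉ ρ → NbhdComplex (complement (G ─v w)) ρ
    from ((ne , v , Vv , ρ⊆N[v]) , w∉ρ) with v ≟ᶠ w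
    ... | no v≢w = ne , v , ─v-V⁺ G w Vv v≢w ,
                   λ u u∈ρ → complement-─v-adj⁺ G w (ρ⊆N[v] u u∈ρ) v≢w (u≢w u∈ρ)
      where
      u≢w : ∀ {u} → u ∈ ρ → u ≢ w
      u≢w u∈ρ refl = w∉ρ u∈ρ
    ... | yes refl = ne , s , ─v-V⁺ G w (~⇒∈V s~w) s≢w , ρ⊆N[s]
      where
      ρ⊆N[s] : ∀ u → u ∈ ρ → E (complement (G ─v w)) s u ≡ true
      ρ⊆N[s] u u∈ρ with complement-adj⁻ G (ρ⊆N[v] u u∈ρ)
      ... | _ , Vu , _ , w≁u = complement-─v-adj⁺ G w
        (complement-adj⁺ G (~⇒∈V s~w) Vu (λ { refl → ≁⇒¬~ w≁u (~-sym s~w) }) (w≁⇒s≁ u≢w w≁u)) s≢w u≢w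
        where
        u≢w : u ≢ w
        u≢w refl = w∉ρ u∈ρ

  nbhd-collapse : Collapses (NbhdComplex (complement G)) (NbhdComplex (complement (G ─v w)))
  nbhd-collapse = collapses-onto-deletion nbhd-cone nbhd-─v⇔

lemma4p8 : ∀ (n : ℕ) (G : Graph n) → Chordal G → HasEdge G →
    ∃[ w ] (NonIsolated G w ×
            Collapses (NbhdComplex (complement G)) (NbhdComplex (complement (G ─v w))) ×
            ∃[ k ] (IsIndepNumber G k × IsIndepNumber (G ─v w) k))
lemma4p8 n G chordal has-edge =
  let s , (w , s~w) , simplicial = simplicial-non-isolated has-edge
      k , α = independence-number G
      open DominatedDeletion G s~w (simplicial⇒N⊆N[] simplicial s~w)
  in w , (s , ~-sym s~w) , nbhd-collapse , k , α , independence-number-─v α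
  where
  open Adjacency G
  open Dirac G chordal
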